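{- Let $x,y$ be real numbers with $x\neq0$, $y\neq0$ and $y^2+4x\ge0$, and put $\Delta=\sqrt{y^2+4x}$, $r=\frac{y+\Delta}{2}$, $s=\frac{y-\Delta}{2}$ (so $r+s=y$, $-rs=x$). Then for every integer $m\ge0$, \[ r^{2m+1}+s^{2m+1}=x^myP_m\!\left(\tfrac{y^2}{x}\right)=y^{2m+1}P^{\rm Inv}_m\!\left(\tfrac{x}{y^2}\right),\qquad r^{2m}+s^{2m}=x^mQ_m\!\left(\tfrac{y^2}{x}\right)=y^{2m}Q^{\rm Inv}_m\!\left(\tfrac{x}{y^2}\right), \] \[ r^{2m+1}-s^{2m+1}=\Delta\,x^m\mathcal{P}_m\!\left(\tfrac{y^2}{x}\right)=\Delta\,y^{2m}\mathcal{P}^{\rm Inv}_m\!\left(\tfrac{x}{y^2}\right), \] and for every integer $m\ge1$, \[ r^{2m}-s^{2m}=\Delta\,\frac{x^m}{y}\mathcal{Q}_m\!\left(\tfrac{y^2}{x}\right)=\Delta\,y^{2m-1}\mathcal{Q}^{\rm Inv}_m\!\left(\tfrac{x}{y^2}\right). \]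
   Context: For integers $n,k\ge0$: $T_k(n)=\binom{n+k+1}{2k+1}+\binom{n+k}{2k+1}$, $U_k(n)=\binom{n+k}{2k}+\binom{n+k-1}{2k}$ for $k\ge1$, $U_0(n)=2$. $P_n(x)=\sum_{k=0}^nT_k(n)x^k$, $Q_n(x)=\sum_{k=0}^nU_k(n)x^k$, $\mathcal{P}_n(x)=\sum_{k=0}^n\binom{n+k}{2k}x^k$, $\mathcal{Q}_n(x)=\sum_{k=1}^n\binom{n+k-1}{2k-1}x^k$ ($n\ge1$). For each family $F^{\rm Inv}_n(x)=x^nF_n(1/x)$. -}

module Defs where

open import Level using (Level; _⊔_) renaming (suc to lsuc)
open import Data.Nat using (ℕ; zero; suc; _∸_) renaming (_+_ to _+ℕ_; _*_ to _*ℕ_)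
open import Data.Nat.Combinatorics using (_C_)
open import Data.Product using (Σ; ∃; _×_)
open import Relation.Nullary using (¬_)
open import Relation.Binary using (Rel; IsTotalOrder)
open import Algebra.Bundles using (CommutativeRing)

-- The real numbers, axiomatised as a complete ordered field
-- (any model is isomorphic to ℝ; stdlib has no reals).

record RealField (c ℓ : Level) : Set (lsuc (c ⊔ ℓ)) where
  field
    commutativeRing : CommutativeRing c ℓ
  open CommutativeRing commutativeRing public
  field
    _≤_          : Rel Carrier ℓ
    isTotalOrder : IsTotalOrder _≈_ _≤_
    +-mono-≤     : ∀ {a b} d → a ≤ b → (a + d) ≤ (b + d)
    *-nonneg     : ∀ {a b} → 0# ≤ a → 0# ≤ b → 0# ≤ (a * b)
    0≉1          : ¬ (0# ≈ 1#)
    inv          : (a : Carrier) → ¬ (a ≈ 0#) → Carrier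
    inv-correct  : ∀ a (p : ¬ (a ≈ 0#)) → (a * inv a p) ≈ 1#
    complete     : (S : Carrier → Set ℓ) → ∃ S →
                   (∃ λ u → ∀ a → S a → a ≤ u) →
                   ∃ λ s → (∀ a → S a → a ≤ s) ×
                           (∀ u → (∀ a → S a → a ≤ u) → s ≤ u)

T : ℕ → ℕ → ℕ
T k n = ((n +ℕ k +ℕ 1) C (2 *ℕ k +ℕ 1)) +ℕ ((n +ℕ k) C (2 *ℕ k +ℕ 1))

U : ℕ → ℕ → ℕ
U zero    n = 2
U (suc k) n = ((n +ℕ suc k) C (2 *ℕ suc k)) +ℕ ((n +ℕ k) C (2 *ℕ suc k))

𝒫c : ℕ → ℕ → ℕ
𝒫c k n = (n +ℕ k) C (2 *ℕ k)

𝒬c : ℕ → ℕ → ℕ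
𝒬c zero    n = 0
𝒬c (suc k) n = (n +ℕ k) C (2 *ℕ k +ℕ 1)

module Eval {c ℓ : Level} (R : CommutativeRing c ℓ) where
  open CommutativeRing R

  ι : ℕ → Carrier
  ι zero    = 0#
  ι (suc n) = 1# + ι n

  pow : Carrier → ℕ → Carrier
  pow a zero    = 1#
  pow a (suc n) = a * pow a n

  sumTo : ℕ → (ℕ → Carrier) → Carrier
  sumTo zero    f = f 0
  sumTo (suc n) f = sumTo n f + f (suc n)

  poly : (ℕ → ℕ → ℕ) → ℕ → Carrier → Carrier
  poly coef n t = sumTo n (λ k → ι (coef k n) * pow t k)

  -- F^Inv_n(t) = t^n F_n(1/t) = Σ_{k=0}^n coef k n · t^(n-k)
  polyInv : (ℕ → ℕ → ℕ) → ℕ → Carrier → Carrier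
  polyInv coef n t = sumTo n (λ k → ι (coef k n) * pow t (n ∸ k))

{-# OPTIONS --safe #-}
-- r and s are the roots of t² = y t + x, so rⁿ ± sⁿ satisfies f (n+2) = y f (n+1) + x f n.
-- Split into even terms x^m E_m and odd terms x^m O_m, and use y² = x u: the recurrence becomes
-- E_{m+1} = u O_m + E_m, O_{m+1} = E_{m+1} + O_m, which are exactly Pascal's rule for the
-- coefficient pairs (U, T) and (𝒬, 𝒫). The reversed forms follow from x = y² v with u v = 1.
module Submission where

open import Defs
open import Level using (Level)
open import Data.Nat as ℕ using (ℕ; zero; suc; z≤n; s≤s) renaming (_≤_ to _≤ℕ_)
import Data.Nat.Properties as ℕₚ
open import Data.Product using (_×_; _,_; map₂; proj₁; proj₂)
open import Data.Sum using (inj₁; inj₂)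
open import Relation.Nullary using (¬_)
open import Relation.Binary using (IsTotalOrder)
import Relation.Binary.PropositionalEquality as ≡
open ≡ using (_≡_)
open import Algebra.Bundles using (CommutativeRing)

module Coefficients where
  open import Data.Nat using (_+_; _*_; _<_)
  open import Data.Nat.Combinatorics using (_C_; nCk+nC[k+1]≡[n+1]C[k+1]; k>n⇒nCk≡0)
  open import Data.Nat.Tactic.RingSolver using (solve-∀)
  open import Algebra.Properties.CommutativeSemigroup ℕₚ.+-commutativeSemigroup using (interchange)
  open ℕₚ using (+-suc; *-suc; +-comm; ≤-reflexive; <⇒≤)
  open ≡ using (refl; sym; trans; cong; cong₂)

  pascal : ∀ n k → suc n C suc k ≡ n C k + n C suc k
  pascal n k = sym (nCk+nC[k+1]≡[n+1]C[k+1] n k)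

  adjacentC : ℕ → ℕ → ℕ
  adjacentC n k = suc n C k + n C k

  adjacentC-pascal : ∀ n k → adjacentC (suc n) (suc k) ≡ adjacentC n k + adjacentC n (suc k)
  adjacentC-pascal n k = trans (cong₂ _+_ (pascal (suc n) k) (pascal n k))
    (interchange (suc n C k) (suc n C suc k) (n C k) (n C suc k))

  adjacentC-vanish : ∀ {n k} → suc n < k → adjacentC n k ≡ 0
  adjacentC-vanish n+1<k = cong₂ _+_ (k>n⇒nCk≡0 n+1<k) (k>n⇒nCk≡0 (<⇒≤ n+1<k))

  shift : (ℕ → ℕ) → ℕ → ℕ
  shift g zero    = 0
  shift g (suc k) = g k

  T-adjacentC : ∀ k m → T k m ≡ adjacentC (m + k) (suc (2 * k))
  T-adjacentC k m = cong₂ (λ n j → n C j + (m + k) C j) (+-comm (m + k) 1) (+-comm (2 * k) 1)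

  U-suc-adjacentC : ∀ k m → U (suc k) m ≡ adjacentC (m + k) (suc (suc (2 * k)))
  U-suc-adjacentC k m = cong₂ (λ n j → n C j + (m + k) C j) (+-suc m k) (*-suc 2 k)

  U-adjacentC : ∀ k m → U k (suc m) ≡ adjacentC (m + k) (2 * k)
  U-adjacentC zero    m = refl
  U-adjacentC (suc k) m =
    trans (U-suc-adjacentC k (suc m)) (cong₂ adjacentC (sym (+-suc m k)) (sym (*-suc 2 k)))

  𝒫c-suc : ∀ k m → 𝒫c (suc k) m ≡ suc (m + k) C suc (suc (2 * k))
  𝒫c-suc k m = cong₂ _C_ (+-suc m k) (*-suc 2 k)

  𝒬c-suc : ∀ k m → 𝒬c (suc k) m ≡ (m + k) C suc (2 * k)
  𝒬c-suc k m = cong ((m + k) C_) (+-comm (2 * k) 1)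

  T-pascal : ∀ k m → T k (suc m) ≡ U k (suc m) + T k m
  T-pascal k m = trans (T-adjacentC k (suc m)) (trans (adjacentC-pascal (m + k) (2 * k))
    (sym (cong₂ _+_ (U-adjacentC k m) (T-adjacentC k m))))

  U-pascal : ∀ k m → U k (suc m) ≡ shift (λ j → T j m) k + U k m
  U-pascal zero    m = refl
  U-pascal (suc k) m = trans (U-suc-adjacentC k (suc m)) (trans (adjacentC-pascal (m + k) (suc (2 * k)))
    (sym (cong₂ _+_ (T-adjacentC k m) (U-suc-adjacentC k m))))

  𝒫c-pascal : ∀ k m → 𝒫c k (suc m) ≡ 𝒬c k (suc m) + 𝒫c k m
  𝒫c-pascal zero    m = refl
  𝒫c-pascal (suc k) m = trans (𝒫c-suc k (suc m)) (trans (pascal (suc (m + k)) (suc (2 * k)))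
    (sym (cong₂ _+_ (𝒬c-suc k (suc m)) (𝒫c-suc k m))))

  𝒬c-pascal : ∀ k m → 𝒬c k (suc m) ≡ shift (λ j → 𝒫c j m) k + 𝒬c k m
  𝒬c-pascal zero    m = refl
  𝒬c-pascal (suc k) m = trans (𝒬c-suc k (suc m)) (trans (pascal (m + k) (2 * k))
    (cong ((m + k) C (2 * k) +_) (sym (𝒬c-suc k m))))

  T-vanish : ∀ m → T (suc m) m ≡ 0
  T-vanish m = trans (T-adjacentC (suc m) m) (adjacentC-vanish (≤-reflexive (index m)))
    where
    index : ∀ m → suc (suc (m + suc m)) ≡ suc (2 * suc m)
    index = solve-∀

  m+m≡2*m : ∀ m → m + m ≡ 2 * m
  m+m≡2*m = solve-∀

  U-vanish : ∀ m → U (suc m) m ≡ 0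
  U-vanish m = trans (U-suc-adjacentC m m)
    (adjacentC-vanish (s≤s (s≤s (≤-reflexive (m+m≡2*m m)))))

  𝒫c-vanish : ∀ m → 𝒫c (suc m) m ≡ 0
  𝒫c-vanish m = trans (𝒫c-suc m m) (k>n⇒nCk≡0 (s≤s (s≤s (≤-reflexive (m+m≡2*m m)))))

  𝒬c-vanish : ∀ m → 𝒬c (suc m) m ≡ 0
  𝒬c-vanish m = trans (𝒬c-suc m m) (k>n⇒nCk≡0 (s≤s (≤-reflexive (m+m≡2*m m))))

open Coefficients

module _ {c ℓ} (R : CommutativeRing c ℓ) where
  open CommutativeRing R
  open Eval R
  open import Algebra.Properties.Ring ring using (-‿distribˡ-*; -‿distribʳ-*; -‿involutive; -‿+-comm)
  open import Algebra.Properties.AbelianGroup +-abelianGroup using (xyx⁻¹≈y)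
  open import Algebra.Properties.CommutativeSemigroup +-commutativeSemigroup
    using () renaming (interchange to +-interchange)
  open import Algebra.Properties.CommutativeSemigroup *-commutativeSemigroup
    using (x∙yz≈y∙xz; xy∙z≈y∙xz; xy∙z≈x∙zy) renaming (interchange to *-interchange)
  open import Algebra.Solver.Ring.NaturalCoefficients.Default commutativeSemiring
    using (solve; _:=_; _:+_; _:*_; _:×_; con; Polynomial)
  open import Relation.Binary.Reasoning.Setoid setoid

  -- The solver reads `con k` as its optimised k × 1#, which is not definitionally ι k.
  :ι : ∀ {n} → ℕ → Polynomial n
  :ι k = k :× con 1

  ι-+ : ∀ a b → ι (a ℕ.+ b) ≈ ι a + ι b
  ι-+ zero    b = sym (+-identityˡ _)
  ι-+ (suc a) b = trans (+-congˡ (ι-+ a b)) (sym (+-assoc _ _ _))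

  pow-cong : ∀ {a b} n → a ≈ b → pow a n ≈ pow b n
  pow-cong zero    a≈b = refl
  pow-cong (suc n) a≈b = *-cong a≈b (pow-cong n a≈b)

  pow-+ : ∀ a m n → pow a (m ℕ.+ n) ≈ pow a m * pow a n
  pow-+ a zero    n = sym (*-identityˡ _)
  pow-+ a (suc m) n = trans (*-congˡ (pow-+ a m n)) (sym (*-assoc _ _ _))

  pow-* : ∀ a b n → pow (a * b) n ≈ pow a n * pow b n
  pow-* a b zero    = sym (*-identityˡ _)
  pow-* a b (suc n) = trans (*-congˡ (pow-* a b n)) (*-interchange a b _ _)

  pow-1# : ∀ n → pow 1# n ≈ 1#
  pow-1# zero    = refl
  pow-1# (suc n) = trans (*-identityˡ _) (pow-1# n)

  pow-2* : ∀ a n → pow a (2 ℕ.* n) ≈ pow (a * a) n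
  pow-2* a n = begin
    pow a (n ℕ.+ (n ℕ.+ 0))   ≈⟨ pow-+ a n (n ℕ.+ 0) ⟩
    pow a n * pow a (n ℕ.+ 0) ≈⟨ *-congˡ (reflexive (≡.cong (pow a) (ℕₚ.+-identityʳ n))) ⟩
    pow a n * pow a n        ≈⟨ sym (pow-* a a n) ⟩
    pow (a * a) n            ∎

  sumTo-cong : ∀ n {f g} → (∀ {k} → k ℕ.≤ n → f k ≈ g k) → sumTo n f ≈ sumTo n g
  sumTo-cong zero    f≈g = f≈g z≤n
  sumTo-cong (suc n) f≈g = +-cong (sumTo-cong n (λ k≤n → f≈g (ℕₚ.m≤n⇒m≤1+n k≤n))) (f≈g ℕₚ.≤-refl)

  sumTo-+ : ∀ n f g → sumTo n f + sumTo n g ≈ sumTo n (λ k → f k + g k)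
  sumTo-+ zero    f g = refl
  sumTo-+ (suc n) f g = trans (+-interchange _ _ _ _) (+-congʳ (sumTo-+ n f g))

  sumTo-*ˡ : ∀ n a f → a * sumTo n f ≈ sumTo n (λ k → a * f k)
  sumTo-*ˡ zero    a f = refl
  sumTo-*ˡ (suc n) a f = trans (distribˡ a _ _) (+-congʳ (sumTo-*ˡ n a f))

  sumTo-unconsˡ : ∀ n f → sumTo (suc n) f ≈ f 0 + sumTo n (λ k → f (suc k))
  sumTo-unconsˡ zero    f = refl
  sumTo-unconsˡ (suc n) f = trans (+-congʳ (sumTo-unconsˡ n f)) (+-assoc _ _ _)

  series : (ℕ → ℕ) → ℕ → Carrier → Carrier
  series g n t = sumTo n (λ k → ι (g k) * pow t k)

  series-cong : ∀ {g h} n t → (∀ k → g k ≡ h k) → series g n t ≈ series h n t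
  series-cong n t g≡h = sumTo-cong n (λ {k} _ → *-congʳ (reflexive (≡.cong ι (g≡h k))))

  series-+ : ∀ g h n t → series g n t + series h n t ≈ series (λ k → g k ℕ.+ h k) n t
  series-+ g h n t = trans (sumTo-+ n _ _)
    (sumTo-cong n (λ {k} _ → sym (trans (*-congʳ (ι-+ (g k) (h k))) (distribʳ _ _ _))))

  series-shift : ∀ g n t → t * series g n t ≈ series (shift g) (suc n) t
  series-shift g n t = sym (begin
    series (shift g) (suc n) t                             ≈⟨ sumTo-unconsˡ n _ ⟩
    0# * 1# + sumTo n (λ k → ι (g k) * (t * pow t k))      ≈⟨ +-congʳ (zeroˡ 1#) ⟩
    0# + sumTo n (λ k → ι (g k) * (t * pow t k))           ≈⟨ +-identityˡ _ ⟩
    sumTo n (λ k → ι (g k) * (t * pow t k))                ≈⟨ sumTo-cong n (λ _ → x∙yz≈y∙xz _ t _) ⟩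
    sumTo n (λ k → t * (ι (g k) * pow t k))                ≈⟨ sumTo-*ˡ n t _ ⟨
    t * series g n t                                       ∎)

  series-vanishing-top : ∀ g n t → g (suc n) ≡ 0 → series g (suc n) t ≈ series g n t
  series-vanishing-top g n t g[n+1]≡0 =
    trans (+-congˡ (trans (*-congʳ (reflexive (≡.cong ι g[n+1]≡0))) (zeroˡ _))) (+-identityʳ _)

  poly-pascal : ∀ coef d e m t → (∀ k → coef k (suc m) ≡ d k ℕ.+ e k m) →
                e (suc m) m ≡ 0 → poly coef (suc m) t ≈ series d (suc m) t + poly e m t
  poly-pascal coef d e m t pascal-rule top≡0 = sym (begin
    series d (suc m) t + poly e m t                  ≈⟨ +-congˡ (series-vanishing-top (λ k → e k m) m t top≡0) ⟨
    series d (suc m) t + series (λ k → e k m) (suc m) t ≈⟨ series-+ d (λ k → e k m) (suc m) t ⟩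
    series (λ k → d k ℕ.+ e k m) (suc m) t           ≈⟨ series-cong (suc m) t (λ k → ≡.sym (pascal-rule k)) ⟩
    poly coef (suc m) t                              ∎)

  poly-T-suc : ∀ m t → poly T (suc m) t ≈ poly U (suc m) t + poly T m t
  poly-T-suc m t = poly-pascal T (λ k → U k (suc m)) T m t (λ k → T-pascal k m) (T-vanish m)

  poly-U-suc : ∀ m t → poly U (suc m) t ≈ t * poly T m t + poly U m t
  poly-U-suc m t = trans (poly-pascal U (shift (λ j → T j m)) U m t (λ k → U-pascal k m) (U-vanish m))
    (+-congʳ (sym (series-shift (λ j → T j m) m t)))

  poly-𝒫-suc : ∀ m t → poly 𝒫c (suc m) t ≈ poly 𝒬c (suc m) t + poly 𝒫c m t
  poly-𝒫-suc m t = poly-pascal 𝒫c (λ k → 𝒬c k (suc m)) 𝒫c m t (λ k → 𝒫c-pascal k m) (𝒫c-vanish m)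

  poly-𝒬-suc : ∀ m t → poly 𝒬c (suc m) t ≈ t * poly 𝒫c m t + poly 𝒬c m t
  poly-𝒬-suc m t = trans (poly-pascal 𝒬c (shift (λ j → 𝒫c j m)) 𝒬c m t (λ k → 𝒬c-pascal k m) (𝒬c-vanish m))
    (+-congʳ (sym (series-shift (λ j → 𝒫c j m) m t)))

  poly-reversal : ∀ {u v} → u * v ≈ 1# → ∀ coef n → pow v n * poly coef n u ≈ polyInv coef n v
  poly-reversal {u} {v} uv≈1 coef n = trans (sumTo-*ˡ n _ _) (sumTo-cong n term)
    where
    term : ∀ {k} → k ℕ.≤ n → pow v n * (ι (coef k n) * pow u k) ≈ ι (coef k n) * pow v (n ℕ.∸ k)
    term {k} k≤n = begin
      pow v n * (ι (coef k n) * pow u k)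
        ≈⟨ *-congʳ (reflexive (≡.cong (pow v) (≡.sym (ℕₚ.m+[n∸m]≡n k≤n)))) ⟩
      pow v (k ℕ.+ (n ℕ.∸ k)) * (ι (coef k n) * pow u k)
        ≈⟨ *-congʳ (pow-+ v k (n ℕ.∸ k)) ⟩
      (pow v k * pow v (n ℕ.∸ k)) * (ι (coef k n) * pow u k)
        ≈⟨ solve 4 (λ p q c r → (p :* q) :* (c :* r) := c :* q :* (r :* p)) refl _ _ _ _ ⟩
      ι (coef k n) * pow v (n ℕ.∸ k) * (pow u k * pow v k)
        ≈⟨ *-congˡ (trans (sym (pow-* u v k)) (trans (pow-cong k uv≈1) (pow-1# k))) ⟩
      ι (coef k n) * pow v (n ℕ.∸ k) * 1#
        ≈⟨ *-identityʳ _ ⟩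
      ι (coef k n) * pow v (n ℕ.∸ k) ∎

  pow-poly-reversal : ∀ {x y u v} → u * v ≈ 1# → x ≈ y * y * v → ∀ coef m →
                      pow x m * poly coef m u ≈ pow y (2 ℕ.* m) * polyInv coef m v
  pow-poly-reversal {x} {y} {u} {v} uv≈1 x≈yyv coef m = begin
    pow x m * poly coef m u                  ≈⟨ *-congʳ (pow-cong m x≈yyv) ⟩
    pow (y * y * v) m * poly coef m u        ≈⟨ *-congʳ (pow-* (y * y) v m) ⟩
    pow (y * y) m * pow v m * poly coef m u  ≈⟨ *-assoc _ _ _ ⟩
    pow (y * y) m * (pow v m * poly coef m u) ≈⟨ *-cong (sym (pow-2* y m)) (poly-reversal uv≈1 coef m) ⟩
    pow y (2 ℕ.* m) * polyInv coef m v       ∎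

  module LinearRecurrence (x y : Carrier) where

    Recurrent : (ℕ → Carrier) → Set ℓ
    Recurrent f = ∀ n → f (suc (suc n)) ≈ y * f (suc n) + x * f n

    pow-recurrent : ∀ {t} → t * t ≈ y * t + x → Recurrent (pow t)
    pow-recurrent {t} t²≈yt+x n = begin
      t * (t * pow t n)             ≈⟨ *-assoc t t _ ⟨
      (t * t) * pow t n             ≈⟨ *-congʳ t²≈yt+x ⟩
      (y * t + x) * pow t n         ≈⟨ solve 4 (λ y t x p → (y :* t :+ x) :* p := y :* (t :* p) :+ x :* p) refl y t x _ ⟩
      y * (t * pow t n) + x * pow t n ∎

    +-recurrent : ∀ {f g} → Recurrent f → Recurrent g → Recurrent (λ n → f n + g n)
    +-recurrent f-rec g-rec n = trans (+-cong (f-rec n) (g-rec n))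
      (solve 6 (λ y x a b c d → (y :* a :+ x :* b) :+ (y :* c :+ x :* d) := y :* (a :+ c) :+ x :* (b :+ d))
             refl y x _ _ _ _)

    neg-recurrent : ∀ {f} → Recurrent f → Recurrent (λ n → - f n)
    neg-recurrent {f} f-rec n = begin
      - f (suc (suc n))                 ≈⟨ -‿cong (f-rec n) ⟩
      - (y * f (suc n) + x * f n)       ≈⟨ -‿+-comm _ _ ⟨
      - (y * f (suc n)) + - (x * f n)   ≈⟨ +-cong (-‿distribʳ-* y _) (-‿distribʳ-* x _) ⟩
      y * - f (suc n) + x * - f n       ∎

    bisection : ∀ {f u a b} (E O : ℕ → Carrier) → Recurrent f → y * y ≈ x * u → b ≈ y * a →
                (∀ m → E (suc m) ≈ u * O m + E m) → (∀ m → O (suc m) ≈ E (suc m) + O m) →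
                f 0 ≈ a * E 0 → f 1 ≈ b * O 0 →
                ∀ m → f (2 ℕ.* m) ≈ a * pow x m * E m × f (2 ℕ.* m ℕ.+ 1) ≈ b * pow x m * O m
    bisection {f} {u} {a} {b} E O f-rec y²≈xu b≈ya E-suc O-suc f0 f1 m =
      map₂ (trans (reflexive (≡.cong f (ℕₚ.+-comm (2 ℕ.* m) 1)))) (bisect m)
      where
      even-step : ∀ m → f (suc (2 ℕ.* m)) ≈ b * pow x m * O m → f (2 ℕ.* m) ≈ a * pow x m * E m →
                  f (suc (suc (2 ℕ.* m))) ≈ a * pow x (suc m) * E (suc m)
      even-step m odd even = begin
        f (suc (suc (2 ℕ.* m)))                       ≈⟨ f-rec (2 ℕ.* m) ⟩
        y * f (suc (2 ℕ.* m)) + x * f (2 ℕ.* m)        ≈⟨ +-cong (*-congˡ odd) (*-congˡ even) ⟩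
        y * (b * X * O m) + x * (a * X * E m)          ≈⟨ +-congʳ (*-congˡ (*-congʳ (*-congʳ b≈ya))) ⟩
        y * (y * a * X * O m) + x * (a * X * E m)
          ≈⟨ solve 6 (λ y x a X o e → y :* (y :* a :* X :* o) :+ x :* (a :* X :* e)
                                     := (y :* y) :* (a :* X :* o) :+ x :* (a :* X :* e)) refl y x a X _ _ ⟩
        (y * y) * (a * X * O m) + x * (a * X * E m)    ≈⟨ +-congʳ (*-congʳ y²≈xu) ⟩
        (x * u) * (a * X * O m) + x * (a * X * E m)
          ≈⟨ solve 6 (λ x u a X o e → (x :* u) :* (a :* X :* o) :+ x :* (a :* X :* e)
                                     := a :* (x :* X) :* (u :* o :+ e)) refl x u a X _ _ ⟩
        a * (x * X) * (u * O m + E m)                  ≈⟨ *-congˡ (E-suc m) ⟨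
        a * (x * X) * E (suc m)                        ∎
        where
        X : Carrier
        X = pow x m

      odd-step : ∀ m → f (suc (suc (2 ℕ.* m))) ≈ a * pow x (suc m) * E (suc m) →
                 f (suc (2 ℕ.* m)) ≈ b * pow x m * O m →
                 f (suc (suc (suc (2 ℕ.* m)))) ≈ b * pow x (suc m) * O (suc m)
      odd-step m even odd = begin
        f (suc (suc (suc (2 ℕ.* m))))                       ≈⟨ f-rec (suc (2 ℕ.* m)) ⟩
        y * f (suc (suc (2 ℕ.* m))) + x * f (suc (2 ℕ.* m)) ≈⟨ +-cong (*-congˡ even) (*-congˡ odd) ⟩
        y * (a * xX * E (suc m)) + x * (b * X * O m)
          ≈⟨ +-congʳ (solve 4 (λ y a Z e → y :* (a :* Z :* e) := (y :* a) :* Z :* e) refl y a xX _) ⟩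
        (y * a) * xX * E (suc m) + x * (b * X * O m)        ≈⟨ +-congʳ (*-congʳ (*-congʳ b≈ya)) ⟨
        b * xX * E (suc m) + x * (b * X * O m)
          ≈⟨ solve 5 (λ b x X e o → b :* (x :* X) :* e :+ x :* (b :* X :* o) := b :* (x :* X) :* (e :+ o))
                   refl b x X _ _ ⟩
        b * xX * (E (suc m) + O m)                          ≈⟨ *-congˡ (O-suc m) ⟨
        b * xX * O (suc m)                                  ∎
        where
        X xX : Carrier
        X = pow x m
        xX = x * X

      bisect : ∀ m → f (2 ℕ.* m) ≈ a * pow x m * E m × f (suc (2 ℕ.* m)) ≈ b * pow x m * O m
      bisect zero = trans f0 (*-congʳ (sym (*-identityʳ a))) , trans f1 (*-congʳ (sym (*-identityʳ b)))
      bisect (suc m) with bisect m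
      ... | even , odd = trans (reflexive (≡.cong f index)) even′
                       , trans (reflexive (≡.cong (λ n → f (suc n)) index)) (odd-step m even′ odd)
        where
        index : 2 ℕ.* suc m ≡ suc (suc (2 ℕ.* m))
        index = ℕₚ.*-suc 2 m
        even′ : f (suc (suc (2 ℕ.* m))) ≈ a * pow x (suc m) * E (suc m)
        even′ = even-step m odd even

  module QuadraticRoots (x y Δ half : Carrier) (2*half≈1 : ι 2 * half ≈ 1#)
                        (Δ²≈y²+4x : Δ * Δ ≈ y * y + ι 4 * x) where

    *2-cancel : ∀ {a b} → ι 2 * a ≈ ι 2 * b → a ≈ b
    *2-cancel {a} {b} 2a≈2b = trans (halve a) (trans (*-congˡ 2a≈2b) (sym (halve b)))
      where
      halve : ∀ a → a ≈ half * (ι 2 * a)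
      halve a = begin
        a                   ≈⟨ *-identityˡ a ⟨
        1# * a              ≈⟨ *-congʳ 2*half≈1 ⟨
        (ι 2 * half) * a    ≈⟨ xy∙z≈y∙xz (ι 2) half a ⟩
        half * (ι 2 * a)    ∎

    root : ∀ {t w} → ι 2 * t ≈ y + w → w * w ≈ y * y + ι 4 * x → t * t ≈ y * t + x
    root {t} {w} 2t≈y+w w²≈y²+4x = *2-cancel (*2-cancel (begin
      ι 2 * (ι 2 * (t * t))          ≈⟨ solve 1 (λ t → :ι 2 :* (:ι 2 :* (t :* t)) := (:ι 2 :* t) :* (:ι 2 :* t)) refl t ⟩
      (ι 2 * t) * (ι 2 * t)          ≈⟨ *-cong 2t≈y+w 2t≈y+w ⟩
      (y + w) * (y + w)              ≈⟨ solve 2 (λ y w → (y :+ w) :* (y :+ w) := y :* y :+ :ι 2 :* y :* w :+ w :* w) refl y w ⟩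
      y * y + ι 2 * y * w + w * w    ≈⟨ +-congˡ w²≈y²+4x ⟩
      y * y + ι 2 * y * w + (y * y + ι 4 * x)
        ≈⟨ solve 3 (λ y w x → y :* y :+ :ι 2 :* y :* w :+ (y :* y :+ :ι 4 :* x)
                              := :ι 2 :* y :* (y :+ w) :+ :ι 4 :* x) refl y w x ⟩
      ι 2 * y * (y + w) + ι 4 * x    ≈⟨ +-congʳ (*-congˡ 2t≈y+w) ⟨
      ι 2 * y * (ι 2 * t) + ι 4 * x
        ≈⟨ solve 3 (λ y t x → :ι 2 :* y :* (:ι 2 :* t) :+ :ι 4 :* x := :ι 2 :* (:ι 2 :* (y :* t :+ x))) refl y t x ⟩
      ι 2 * (ι 2 * (y * t + x))      ∎))

    module _ (r s : Carrier) (2r≈y+Δ : ι 2 * r ≈ y + Δ) (2s≈y-Δ : ι 2 * s ≈ y - Δ) where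

      r-root : r * r ≈ y * r + x
      r-root = root 2r≈y+Δ Δ²≈y²+4x

      s-root : s * s ≈ y * s + x
      s-root = root 2s≈y-Δ (trans neg-square Δ²≈y²+4x)
        where
        neg-square : - Δ * - Δ ≈ Δ * Δ
        neg-square = begin
          - Δ * - Δ        ≈⟨ -‿distribˡ-* Δ (- Δ) ⟨
          - (Δ * - Δ)      ≈⟨ -‿cong (-‿distribʳ-* Δ Δ) ⟨
          - (- (Δ * Δ))    ≈⟨ -‿involutive _ ⟩
          Δ * Δ            ∎

      r+s≈y : r + s ≈ y
      r+s≈y = *2-cancel (begin
        ι 2 * (r + s)          ≈⟨ distribˡ _ _ _ ⟩
        ι 2 * r + ι 2 * s      ≈⟨ +-cong 2r≈y+Δ 2s≈y-Δ ⟩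
        (y + Δ) + (y + - Δ)    ≈⟨ solve 3 (λ y d e → (y :+ d) :+ (y :+ e) := :ι 2 :* y :+ (d :+ e)) refl y Δ (- Δ) ⟩
        ι 2 * y + (Δ - Δ)      ≈⟨ +-congˡ (-‿inverseʳ Δ) ⟩
        ι 2 * y + 0#           ≈⟨ +-identityʳ _ ⟩
        ι 2 * y                ∎)

      r-s≈Δ : r - s ≈ Δ
      r-s≈Δ = trans (+-congʳ (sym s+Δ≈r)) (xyx⁻¹≈y s Δ)
        where
        s+Δ≈r : s + Δ ≈ r
        s+Δ≈r = *2-cancel (begin
          ι 2 * (s + Δ)          ≈⟨ distribˡ _ _ _ ⟩
          ι 2 * s + ι 2 * Δ      ≈⟨ +-congʳ 2s≈y-Δ ⟩
          (y + - Δ) + ι 2 * Δ    ≈⟨ solve 3 (λ y d e → (y :+ e) :+ :ι 2 :* d := (y :+ d) :+ (d :+ e)) refl y Δ (- Δ) ⟩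
          (y + Δ) + (Δ - Δ)      ≈⟨ +-congˡ (-‿inverseʳ Δ) ⟩
          (y + Δ) + 0#           ≈⟨ +-identityʳ _ ⟩
          y + Δ                  ≈⟨ 2r≈y+Δ ⟨
          ι 2 * r                ∎)

  module PowerSumExpansions (x y Δ r s xi yi half : Carrier)
    (x*xi≈1 : x * xi ≈ 1#) (y*yi≈1 : y * yi ≈ 1#) (2*half≈1 : ι 2 * half ≈ 1#)
    (Δ²≈y²+4x : Δ * Δ ≈ y * y + ι 4 * x) (2r≈y+Δ : ι 2 * r ≈ y + Δ) (2s≈y-Δ : ι 2 * s ≈ y - Δ) where

    open QuadraticRoots x y Δ half 2*half≈1 Δ²≈y²+4x
    open LinearRecurrence x y

    u v : Carrier
    u = y * y * xi
    v = x * yi * yi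

    y²≈xu : y * y ≈ x * u
    y²≈xu = begin
      y * y               ≈⟨ *-identityʳ _ ⟨
      y * y * 1#          ≈⟨ *-congˡ x*xi≈1 ⟨
      y * y * (x * xi)    ≈⟨ solve 3 (λ y x i → y :* y :* (x :* i) := x :* (y :* y :* i)) refl y x xi ⟩
      x * u               ∎

    x≈y²v : x ≈ y * y * v
    x≈y²v = begin
      x                        ≈⟨ trans (*-identityʳ _) (*-identityʳ _) ⟨
      x * 1# * 1#              ≈⟨ *-cong (*-congˡ y*yi≈1) y*yi≈1 ⟨
      x * (y * yi) * (y * yi)  ≈⟨ solve 3 (λ x y i → x :* (y :* i) :* (y :* i) := y :* y :* (x :* i :* i)) refl x y yi ⟩
      y * y * v                ∎

    uv≈1 : u * v ≈ 1#
    uv≈1 = begin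
      u * v                              ≈⟨ solve 4 (λ x y i j → y :* y :* i :* (x :* j :* j) := x :* i :* (y :* j) :* (y :* j)) refl x y xi yi ⟩
      x * xi * (y * yi) * (y * yi)       ≈⟨ *-cong (*-cong x*xi≈1 y*yi≈1) y*yi≈1 ⟩
      1# * 1# * 1#                       ≈⟨ trans (*-identityʳ _) (*-identityʳ _) ⟩
      1#                                 ∎

    y[Δyi]≈Δ : y * (Δ * yi) ≈ Δ
    y[Δyi]≈Δ = trans (x∙yz≈y∙xz y Δ yi) (trans (*-congˡ y*yi≈1) (*-identityʳ Δ))

    power-sum-bisection : ∀ m →
      pow r (2 ℕ.* m) + pow s (2 ℕ.* m) ≈ 1# * pow x m * poly U m u ×
      pow r (2 ℕ.* m ℕ.+ 1) + pow s (2 ℕ.* m ℕ.+ 1) ≈ y * pow x m * poly T m u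
    power-sum-bisection = bisection (λ m → poly U m u) (λ m → poly T m u)
      (+-recurrent (pow-recurrent (r-root r s 2r≈y+Δ 2s≈y-Δ)) (pow-recurrent (s-root r s 2r≈y+Δ 2s≈y-Δ)))
      y²≈xu (sym (*-identityʳ y)) (λ m → poly-U-suc m u) (λ m → poly-T-suc m u)
      (solve 0 (con 1 :+ con 1 := con 1 :* (:ι 2 :* con 1)) refl)
      (trans (+-cong (*-identityʳ r) (*-identityʳ s))
             (trans (r+s≈y r s 2r≈y+Δ 2s≈y-Δ) (solve 1 (λ y → y := y :* (:ι 1 :* con 1)) refl y)))

    power-difference-bisection : ∀ m →
      pow r (2 ℕ.* m) - pow s (2 ℕ.* m) ≈ Δ * yi * pow x m * poly 𝒬c m u ×
      pow r (2 ℕ.* m ℕ.+ 1) - pow s (2 ℕ.* m ℕ.+ 1) ≈ Δ * pow x m * poly 𝒫c m u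
    power-difference-bisection = bisection (λ m → poly 𝒬c m u) (λ m → poly 𝒫c m u)
      (+-recurrent (pow-recurrent (r-root r s 2r≈y+Δ 2s≈y-Δ))
                   (neg-recurrent (pow-recurrent (s-root r s 2r≈y+Δ 2s≈y-Δ))))
      y²≈xu (sym y[Δyi]≈Δ) (λ m → poly-𝒬-suc m u) (λ m → poly-𝒫-suc m u)
      (trans (-‿inverseʳ 1#) (solve 2 (λ d i → con 0 := d :* i :* (con 0 :* con 1)) refl Δ yi))
      (trans (+-cong (*-identityʳ r) (-‿cong (*-identityʳ s)))
             (trans (r-s≈Δ r s 2r≈y+Δ 2s≈y-Δ) (solve 1 (λ d → d := d :* (:ι 1 :* con 1)) refl Δ)))

    reversal : ∀ coef m → pow x m * poly coef m u ≈ pow y (2 ℕ.* m) * polyInv coef m v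
    reversal = pow-poly-reversal uv≈1 x≈y²v

    odd-power-sum : ∀ m → pow r (2 ℕ.* m ℕ.+ 1) + pow s (2 ℕ.* m ℕ.+ 1) ≈ pow x m * y * poly T m u
    odd-power-sum m = trans (proj₂ (power-sum-bisection m)) (*-congʳ (*-comm y _))

    odd-power-sum-reversed : ∀ m → pow x m * y * poly T m u ≈ pow y (2 ℕ.* m ℕ.+ 1) * polyInv T m v
    odd-power-sum-reversed m = begin
      pow x m * y * poly T m u              ≈⟨ xy∙z≈y∙xz _ y _ ⟩
      y * (pow x m * poly T m u)            ≈⟨ *-congˡ (reversal T m) ⟩
      y * (pow y (2 ℕ.* m) * polyInv T m v) ≈⟨ *-assoc _ _ _ ⟨
      pow y (suc (2 ℕ.* m)) * polyInv T m v ≈⟨ *-congʳ (reflexive (≡.cong (pow y) (ℕₚ.+-comm 1 (2 ℕ.* m)))) ⟩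
      pow y (2 ℕ.* m ℕ.+ 1) * polyInv T m v ∎

    even-power-sum : ∀ m → pow r (2 ℕ.* m) + pow s (2 ℕ.* m) ≈ pow x m * poly U m u
    even-power-sum m = trans (proj₁ (power-sum-bisection m)) (*-congʳ (*-identityˡ _))

    odd-power-difference : ∀ m → pow r (2 ℕ.* m ℕ.+ 1) - pow s (2 ℕ.* m ℕ.+ 1) ≈ Δ * pow x m * poly 𝒫c m u
    odd-power-difference m = proj₂ (power-difference-bisection m)

    odd-power-difference-reversed : ∀ m → Δ * pow x m * poly 𝒫c m u ≈ Δ * pow y (2 ℕ.* m) * polyInv 𝒫c m v
    odd-power-difference-reversed m =
      trans (*-assoc _ _ _) (trans (*-congˡ (reversal 𝒫c m)) (sym (*-assoc _ _ _)))

    even-power-difference : ∀ m → pow r (2 ℕ.* m) - pow s (2 ℕ.* m) ≈ Δ * (pow x m * yi) * poly 𝒬c m u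
    even-power-difference m = trans (proj₁ (power-difference-bisection m))
      (*-congʳ (xy∙z≈x∙zy Δ yi _))

    even-power-difference-reversed : ∀ m → 1 ℕ.≤ m →
      Δ * (pow x m * yi) * poly 𝒬c m u ≈ Δ * pow y (2 ℕ.* m ℕ.∸ 1) * polyInv 𝒬c m v
    even-power-difference-reversed (suc k) _ = begin
      Δ * (pow x m * yi) * poly 𝒬c m u        ≈⟨ solve 4 (λ d X i q → d :* (X :* i) :* q := d :* i :* (X :* q)) refl Δ _ yi _ ⟩
      Δ * yi * (pow x m * poly 𝒬c m u)        ≈⟨ *-congˡ (reversal 𝒬c m) ⟩
      Δ * yi * (y * Y * polyInv 𝒬c m v)
        ≈⟨ solve 5 (λ d i y Y p → d :* i :* (y :* Y :* p) := y :* i :* (d :* Y :* p)) refl Δ yi y Y _ ⟩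
      y * yi * (Δ * Y * polyInv 𝒬c m v)      ≈⟨ *-congʳ y*yi≈1 ⟩
      1# * (Δ * Y * polyInv 𝒬c m v)          ≈⟨ *-identityˡ _ ⟩
      Δ * Y * polyInv 𝒬c m v                 ∎
      where
      m : ℕ
      m = suc k
      Y : Carrier
      Y = pow y (2 ℕ.* m ℕ.∸ 1)

module _ {c ℓ} (R : RealField c ℓ) where
  open RealField R
  open Eval commutativeRing
  open import Algebra.Properties.Ring ring using (-1*x≈-x; -‿involutive)
  private module ≤ = IsTotalOrder isTotalOrder

  0≤1 : 0# ≤ 1#
  0≤1 with ≤.total 0# 1#
  ... | inj₁ 0≤1 = 0≤1
  ... | inj₂ 1≤0 = ≤.≤-respʳ-≈ (trans (-1*x≈-x (- 1#)) (-‿involutive 1#)) (*-nonneg 0≤-1 0≤-1)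
    where
    0≤-1 : 0# ≤ (- 1#)
    0≤-1 = ≤.≤-respʳ-≈ (+-identityˡ _) (≤.≤-respˡ-≈ (-‿inverseʳ 1#) (+-mono-≤ (- 1#) 1≤0))

  ι2≉0 : ¬ (ι 2 ≈ 0#)
  ι2≉0 2≈0 = 0≉1 (≤.antisym 0≤1 1≤0)
    where
    1≤0 : 1# ≤ 0#
    1≤0 = ≤.≤-respˡ-≈ (+-identityˡ 1#)
            (≤.≤-respʳ-≈ (trans (+-congˡ (sym (+-identityʳ 1#))) 2≈0) (+-mono-≤ 1# 0≤1))

lemma3p1 : {c ℓ : Level} (R : RealField c ℓ) →
  let open RealField R
      open Eval commutativeRing
  in (x y : Carrier) (hx : ¬ (x ≈ 0#)) (hy : ¬ (y ≈ 0#)) →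
     0# ≤ (y * y + ι 4 * x) →
     (Δ : Carrier) → 0# ≤ Δ → (Δ * Δ) ≈ (y * y + ι 4 * x) →
     (r s : Carrier) → (ι 2 * r) ≈ (y + Δ) → (ι 2 * s) ≈ (y - Δ) →
     let u = y * y * inv x hx
         v = x * inv y hy * inv y hy
     in ((m : ℕ) →
           ((pow r (2 ℕ.* m ℕ.+ 1) + pow s (2 ℕ.* m ℕ.+ 1)) ≈ (pow x m * y * poly T m u)
             × (pow x m * y * poly T m u) ≈ (pow y (2 ℕ.* m ℕ.+ 1) * polyInv T m v))
         × ((pow r (2 ℕ.* m) + pow s (2 ℕ.* m)) ≈ (pow x m * poly U m u)
             × (pow x m * poly U m u) ≈ (pow y (2 ℕ.* m) * polyInv U m v))
         × ((pow r (2 ℕ.* m ℕ.+ 1) - pow s (2 ℕ.* m ℕ.+ 1)) ≈ (Δ * pow x m * poly 𝒫c m u)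
             × (Δ * pow x m * poly 𝒫c m u) ≈ (Δ * pow y (2 ℕ.* m) * polyInv 𝒫c m v)))
      × ((m : ℕ) → 1 ≤ℕ m →
           ((pow r (2 ℕ.* m) - pow s (2 ℕ.* m)) ≈ (Δ * (pow x m * inv y hy) * poly 𝒬c m u)
             × (Δ * (pow x m * inv y hy) * poly 𝒬c m u) ≈ (Δ * pow y (2 ℕ.* m ℕ.∸ 1) * polyInv 𝒬c m v)))
lemma3p1 R x y hx hy _ Δ _ Δ²≈y²+4x r s 2r≈y+Δ 2s≈y-Δ =
    (λ m → (odd-power-sum m , odd-power-sum-reversed m)
         , (even-power-sum m , reversal U m)
         , (odd-power-difference m , odd-power-difference-reversed m))
  , (λ m 1≤m → even-power-difference m , even-power-difference-reversed m 1≤m)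
  where
  open RealField R
  open Eval commutativeRing
  open PowerSumExpansions commutativeRing x y Δ r s (inv x hx) (inv y hy) (inv (ι 2) (ι2≉0 R))
    (inv-correct x hx) (inv-correct y hy) (inv-correct (ι 2) (ι2≉0 R)) Δ²≈y²+4x 2r≈y+Δ 2s≈y-Δ
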